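{- If $G$ and $H$ are connected graphs, then $$\chi_{\mu_i}(G\boxtimes H)\ge \max\left\{\left\lceil\frac{\operatorname{diag}(G\boxtimes H)}{2}\right\rceil,\ \omega(G)\,\omega(H)\right\}.$$
   Context: All graphs are finite and simple. The strong product $G\boxtimes H$ has vertex set $V(G)\times V(H)$, with distinct $(g,h),(g',h')$ adjacent iff ($g=g'$ or $gg'\in E(G)$) and ($h=h'$ or $hh'\in E(H)$). $\omega$ is the clique number. A subgraph of a graph is convex if every geodesic (shortest path) between two of its vertices lies entirely in it; a convex path is a path subgraph that is convex. If $g_1\dots g_k$ and $h_1\dots h_k$ are convex paths in $G$ and $H$, the subgraph of $G\boxtimes H$ induced by $\{(g_1,h_1),\dots,(g_k,h_k)\}$ is a diagonal; $\operatorname{diag}(G\boxtimes H)$ is the maximum number of vertices of a diagonal in $G\boxtimes H$. For $X\subseteq V$, two vertices $x,y\in X$ are $X$-visible if some $x,y$-geodesic has no internal vertex in $X$; $X$ is an independent mutual-visibility (IMV) set if $X$ is independent and every two of its vertices are $X$-visible. $\chi_{\mu_i}$ is the least $k$ such that the vertex set can be partitioned into $k$ IMV sets. -}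

module Defs where

open import Level using (0ℓ)
open import Data.Nat using (ℕ; zero; suc; _≤_; _<_)
open import Data.Fin using (Fin; toℕ; fromℕ; inject₁) renaming (zero to fz; suc to fs)
open import Data.Product using (Σ; ∃; ∃-syntax; _×_; _,_)
open import Data.Sum using (_⊎_)
open import Relation.Nullary using (¬_; Dec)
open import Relation.Binary.PropositionalEquality using (_≡_; _≢_)
open import Relation.Binary using (Decidable)

record Graph : Set₁ where
  field
    n      : ℕ
    Adj    : Fin n → Fin n → Set
    adj?   : Decidable Adj
    sym    : ∀ {x y} → Adj x y → Adj y x
    irrefl : ∀ {x} → ¬ Adj x x

-- All graph-theoretic notions below are stated for an arbitrary vertex
-- type V with an adjacency relation Adj, so that they apply both to
-- graphs G (V = Fin n) and to the strong product (V = Fin n × Fin m).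

module _ {V : Set} (Adj : V → V → Set) where

  record Walk (x y : V) (k : ℕ) : Set where
    field
      w     : Fin (suc k) → V
      start : w fz ≡ x
      end   : w (fromℕ k) ≡ y
      step  : ∀ (i : Fin k) → Adj (w (inject₁ i)) (w (fs i))

  record Geodesic (x y : V) (k : ℕ) : Set where
    field
      walk     : Walk x y k
      shortest : ∀ m → m < k → ¬ Walk x y m

  Connected : Set
  Connected = ∀ (x y : V) → ∃[ k ] Walk x y k

  IsClique : (a : ℕ) → (Fin a → V) → Set
  IsClique a f = ∀ (i j : Fin a) → i ≢ j → Adj (f i) (f j)

  HasClique : ℕ → Set
  HasClique a = Σ (Fin a → V) (IsClique a)

  IsCliqueNumber : ℕ → Set
  IsCliqueNumber w = HasClique w × (∀ a → HasClique a → a ≤ w)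

  IsPath : (k : ℕ) → (Fin k → V) → Set
  IsPath k P = (∀ i j → P i ≡ P j → i ≡ j)
             × (∀ i j → toℕ j ≡ suc (toℕ i) → Adj (P i) (P j))

  VertexOf : ∀ {k} → (Fin k → V) → V → Set
  VertexOf {k} P u = ∃[ t ] u ≡ P t

  EdgeOf : ∀ {k} → (Fin k → V) → V → V → Set
  EdgeOf {k} P u v = ∃[ s ] ∃[ t ]
    ((toℕ t ≡ suc (toℕ s) ⊎ toℕ s ≡ suc (toℕ t)) × u ≡ P s × v ≡ P t)

  IsConvexPath : (k : ℕ) → (Fin k → V) → Set
  IsConvexPath k P = IsPath k P ×
    (∀ (i j : Fin k) (l : ℕ) (g : Geodesic (P i) (P j) l) →
       let w = Walk.w (Geodesic.walk g) in
       (∀ (r : Fin (suc l)) → VertexOf P (w r))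
       × (∀ (r : Fin l) → EdgeOf P (w (inject₁ r)) (w (fs r))))

  Visible : (V → Set) → V → V → Set
  Visible X x y = ∃[ l ] Σ (Geodesic x y l) λ g →
    ∀ (r : Fin (suc l)) → 0 < toℕ r → toℕ r < l →
      ¬ X (Walk.w (Geodesic.walk g) r)

  IsIMV : (V → Set) → Set
  IsIMV X = (∀ x y → X x → X y → ¬ Adj x y)
          × (∀ x y → X x → X y → Visible X x y)

  IMVPartition : ℕ → Set
  IMVPartition k = Σ (V → Fin k) λ c → ∀ (j : Fin k) → IsIMV (λ x → c x ≡ j)

  IsChiMuI : ℕ → Set
  IsChiMuI c = IMVPartition c × (∀ k → IMVPartition k → c ≤ k)

module _ (G H : Graph) where
  open Graph

  StrongAdj : Fin (n G) × Fin (n H) → Fin (n G) × Fin (n H) → Set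
  StrongAdj (g , h) (g' , h') =
    ¬ ((g , h) ≡ (g' , h'))
    × (g ≡ g' ⊎ Adj G g g')
    × (h ≡ h' ⊎ Adj H h h')

  -- A diagonal with k vertices: convex paths g₁…g_k in G and h₁…h_k in H;
  -- the diagonal is induced by {(g_i , h_i)}, which has k vertices.
  HasDiagonal : ℕ → Set
  HasDiagonal k = Σ (Fin k → Fin (n G)) λ g → Σ (Fin k → Fin (n H)) λ h →
    IsConvexPath (Adj G) k g × IsConvexPath (Adj H) k h

  IsDiagNumber : ℕ → Set
  IsDiagNumber d = HasDiagonal d × (∀ k → HasDiagonal k → k ≤ d)

{-# OPTIONS --safe #-}
module Submission where

-- Each colour class of an IMV partition of G ⊠ H is independent, so it meets the product of a
-- maximum clique of G and one of H, itself a clique, at most once.  For a diagonal (gᵢ , hᵢ),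
-- the two projections of a geodesic from (g_a , h_a) to (g_e , h_e) are lazy walks of length at
-- most e − a between vertices of convex paths; a convex path is isometric, so neither projection
-- can pause or leave its path, and the geodesic is the diagonal itself.  Hence no IMV set
-- contains three diagonal vertices, and every colour meets the diagonal at most twice.

open import Defs
open import Data.Nat using (ℕ; _≤_; _*_; _⊔_; ⌈_/2⌉)
open import Data.Nat using (zero; suc; _+_; _∸_; _<_; s≤s)
open import Data.Nat.Induction using (<-wellFounded)
open import Data.Nat.Properties
open import Data.Fin as Fin using (Fin; toℕ; fromℕ; fromℕ<; inject₁; join; splitAt; remQuot; combine)
  renaming (zero to fz; suc to fs)
import Data.Fin.Properties as Finₚ
open import Data.Product using (∃-syntax; _×_; _,_; proj₁; proj₂; uncurry)
open import Data.Sum using (_⊎_; inj₁; inj₂)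
open import Data.Sum.Properties using (inj₁-injective; inj₂-injective)
open import Data.Empty using (⊥; ⊥-elim)
open import Function using (_∘_)
open import Induction.WellFounded using (Acc; acc)
open import Relation.Nullary using (¬_; Dec; yes; no)
open import Relation.Nullary.Decidable using (map′; _×-dec_)
open import Relation.Binary using (Decidable; tri<; tri≈; tri>)
open import Relation.Binary.PropositionalEquality

module _ {V : Set} {R : V → V → Set} where

  empty-walk : ∀ {x y} → x ≡ y → Walk R x y 0
  empty-walk {x} x≡y = record { w = λ _ → x ; start = refl ; end = x≡y ; step = λ () }

  infixr 5 _◅_
  _◅_ : ∀ {x z y k} → R x z → Walk R z y k → Walk R x y (suc k)
  _◅_ {x} {k = k} r u = record { w = vertex ; start = refl ; end = Walk.end u ; step = edge }
    where
    vertex : Fin (suc (suc k)) → V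
    vertex fz = x
    vertex (fs i) = Walk.w u i
    edge : ∀ i → R (vertex (inject₁ i)) (vertex (fs i))
    edge fz = subst (R x) (sym (Walk.start u)) r
    edge (fs i) = Walk.step u i

  tail : ∀ {x y k} (u : Walk R x y (suc k)) → Walk R (Walk.w u (fs fz)) y k
  tail u = record { w = Walk.w u ∘ fs ; start = refl ; end = Walk.end u ; step = Walk.step u ∘ fs }

  subst-start : ∀ {x x′ y k} → x ≡ x′ → Walk R x y k → Walk R x′ y k
  subst-start refl u = u

  first-step : ∀ {x y k} (u : Walk R x y (suc k)) → R x (Walk.w u (fs fz))
  first-step u = subst (λ v → R v _) (Walk.start u) (Walk.step u fz)

  geodesic-minimal : ∀ {x y l m} → Geodesic R x y l → Walk R x y m → l ≤ m
  geodesic-minimal γ u = ≮⇒≥ (λ m<l → Geodesic.shortest γ _ m<l u)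

walk-map : ∀ {V W : Set} {R : V → V → Set} {S : W → W → Set} (f : V → W) →
           (∀ {x y} → R x y → S (f x) (f y)) → ∀ {x y k} → Walk R x y k → Walk S (f x) (f y) k
walk-map f f-hom u = record
  { w = f ∘ Walk.w u ; start = cong f (Walk.start u) ; end = cong f (Walk.end u) ; step = f-hom ∘ Walk.step u }

module _ {V : Set} {R : V → V → Set} {d : ℕ} {P : Fin d → V}
         (consecutive : ∀ i j → toℕ j ≡ suc (toℕ i) → R (P i) (P j)) where

  path-segment : ∀ a k e → toℕ a + k ≡ toℕ e → Walk R (P a) (P e) k
  path-segment a zero e a+0≡e =
    empty-walk (cong P (Finₚ.toℕ-injective (trans (sym (+-identityʳ (toℕ a))) a+0≡e)))
  path-segment a (suc k) e a+1+k≡e =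
    consecutive a next (Finₚ.toℕ-fromℕ< next<d) ◅ path-segment next k e next+k≡e
    where
    1+a≤e : suc (toℕ a) ≤ toℕ e
    1+a≤e = subst (suc (toℕ a) ≤_) (trans (sym (+-suc (toℕ a) k)) a+1+k≡e) (s≤s (m≤m+n (toℕ a) k))
    next<d : suc (toℕ a) < d
    next<d = ≤-<-trans 1+a≤e (Finₚ.toℕ<n e)
    next : Fin d
    next = fromℕ< next<d
    next+k≡e : toℕ next + k ≡ toℕ e
    next+k≡e = trans (cong (_+ k) (Finₚ.toℕ-fromℕ< next<d)) (trans (sym (+-suc (toℕ a) k)) a+1+k≡e)

Lazy : {V : Set} → (V → V → Set) → V → V → Set
Lazy R x y = x ≡ y ⊎ R x y

module _ {V : Set} {R : V → V → Set} where

  Strict : ∀ {x y l} → Walk (Lazy R) x y l → Set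
  Strict {l = l} u = ∀ (i : Fin l) → R (Walk.w u (inject₁ i)) (Walk.w u (fs i))

  strict-walk : ∀ {x y l} (u : Walk (Lazy R) x y l) → Strict u → Walk R x y l
  strict-walk u strict = record { w = Walk.w u ; start = Walk.start u ; end = Walk.end u ; step = strict }

  strict-or-shorter : ∀ {x y l} (u : Walk (Lazy R) x y l) → Strict u ⊎ ∃[ k ] k < l × Walk R x y k
  strict-or-shorter {l = zero} u = inj₁ λ ()
  strict-or-shorter {l = suc l} u with Walk.step u fz | strict-or-shorter (tail u)
  ... | inj₁ stay | inj₁ strict =
    inj₂ (l , ≤-refl , subst-start (trans (sym stay) (Walk.start u)) (strict-walk (tail u) strict))
  ... | inj₁ stay | inj₂ (k , k<l , v) =
    inj₂ (k , m<n⇒m<1+n k<l , subst-start (trans (sym stay) (Walk.start u)) v)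
  ... | inj₂ r | inj₁ strict = inj₁ λ { fz → r ; (fs i) → strict i }
  ... | inj₂ r | inj₂ (k , k<l , v) = inj₂ (suc k , s≤s k<l , subst (λ v → R v _) (Walk.start u) r ◅ v)

module _ {P : ℕ → Set} (P? : ∀ k → Dec (P k)) where

  least-witness : ∀ {m} → P m → ∃[ k ] k ≤ m × P k × (∀ j → j < k → ¬ P j)
  least-witness = search (<-wellFounded _)
    where
    search : ∀ {m} → Acc _<_ m → P m → ∃[ k ] k ≤ m × P k × (∀ j → j < k → ¬ P j)
    search {m} (acc below) pm with anyUpTo? P? m
    ... | no none = m , ≤-refl , pm , λ j j<m pj → none (j , j<m , pj)
    ... | yes (j , j<m , pj) with search (below j<m) pj
    ...   | k , k≤j , pk , least = k , ≤-trans k≤j (<⇒≤ j<m) , pk , least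

module _ {n : ℕ} {R : Fin n → Fin n → Set} (R? : Decidable R) where

  walk? : ∀ x y k → Dec (Walk R x y k)
  walk? x y zero = map′ empty-walk (λ u → trans (sym (Walk.start u)) (Walk.end u)) (x Finₚ.≟ y)
  walk? x y (suc k) = map′ (λ (_ , r , u) → r ◅ u) (λ u → _ , first-step u , tail u)
                           (Finₚ.any? λ z → R? x z ×-dec walk? z y k)

  shortest-walk : ∀ {x y m} → Walk R x y m → ∃[ k ] k ≤ m × Geodesic R x y k
  shortest-walk {x} {y} u with least-witness (walk? x y) u
  ... | k , k≤m , v , none = k , k≤m , record { walk = v ; shortest = none }

RisesByAtMostOne : ∀ {m} → (Fin (suc m) → ℕ) → Set
RisesByAtMostOne s = ∀ i → s (fs i) ≤ suc (s (inject₁ i))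

module _ where
  open ≤-Reasoning

  rises-from-start : ∀ {m} {s : Fin (suc m) → ℕ} → RisesByAtMostOne s → ∀ r → s r ≤ s fz + toℕ r
  rises-from-start {s = s} rises fz = m≤m+n (s fz) 0
  rises-from-start {zero} rises (fs ())
  rises-from-start {suc m} {s} rises (fs r) = begin
    s (fs r)               ≤⟨ rises-from-start (rises ∘ fs) r ⟩
    s (fs fz) + toℕ r      ≤⟨ +-monoˡ-≤ (toℕ r) (rises fz) ⟩
    suc (s fz) + toℕ r     ≡⟨ +-suc (s fz) (toℕ r) ⟨
    s fz + toℕ (fs r)      ∎

  rises-to-end : ∀ {m} {s : Fin (suc m) → ℕ} → RisesByAtMostOne s → ∀ r → s (fromℕ m) ≤ s r + (m ∸ toℕ r)
  rises-to-end {m} {s} rises fz =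
    subst (λ k → s (fromℕ m) ≤ s fz + k) (Finₚ.toℕ-fromℕ m) (rises-from-start {s = s} rises (fromℕ m))
  rises-to-end {zero} rises (fs ())
  rises-to-end {suc m} rises (fs r) = rises-to-end (rises ∘ fs) r

  rises-tightly : ∀ {m} {s : Fin (suc m) → ℕ} → RisesByAtMostOne s → s fz + m ≤ s (fromℕ m) →
                  ∀ r → s r ≡ s fz + toℕ r
  rises-tightly {m} {s} rises tight r =
    ≤-antisym (rises-from-start rises r) (+-cancelʳ-≤ (m ∸ toℕ r) _ _ (begin
      s fz + toℕ r + (m ∸ toℕ r)    ≡⟨ +-assoc (s fz) (toℕ r) (m ∸ toℕ r) ⟩
      s fz + (toℕ r + (m ∸ toℕ r))  ≡⟨ cong (s fz +_) (m+[n∸m]≡n (Finₚ.toℕ≤pred[n] r)) ⟩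
      s fz + m                      ≤⟨ tight ⟩
      s (fromℕ m)                   ≤⟨ rises-to-end rises r ⟩
      s r + (m ∸ toℕ r)             ∎))

module ConvexPath {n : ℕ} {R : Fin n → Fin n → Set} (R? : Decidable R)
                  {d : ℕ} {P : Fin d → Fin n} (convex : IsConvexPath R d P) where

  P-injective : ∀ i j → P i ≡ P j → i ≡ j
  P-injective = proj₁ (proj₁ convex)

  module OnGeodesic {i j l} (γ : Geodesic R (P i) (P j) l) where
    open Walk (Geodesic.walk γ)

    private
      inside = proj₂ convex i j l γ

    index : Fin (suc l) → Fin d
    index r = proj₁ (proj₁ inside r)

    index-spec : ∀ r → w r ≡ P (index r)
    index-spec r = proj₂ (proj₁ inside r)

    index-start : index fz ≡ i
    index-start = P-injective _ _ (trans (sym (index-spec fz)) start)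

    index-end : index (fromℕ l) ≡ j
    index-end = P-injective _ _ (trans (sym (index-spec (fromℕ l))) end)

    index-rises : RisesByAtMostOne (toℕ ∘ index)
    index-rises r with proj₂ inside r
    ... | _ , _ , adjacent , ws , wt
        with refl ← P-injective _ _ (trans (sym (index-spec (inject₁ r))) ws)
           | refl ← P-injective _ _ (trans (sym (index-spec (fs r))) wt)
        with adjacent
    ...   | inj₁ forward  = ≤-reflexive forward
    ...   | inj₂ backward = m≤n⇒m≤1+n (≤-trans (n≤1+n _) (≤-reflexive (sym backward)))

    geodesic-span : toℕ j ≤ toℕ i + l
    geodesic-span = subst₂ (λ a b → toℕ b ≤ toℕ a + l) index-start index-end
      (subst (λ k → toℕ (index (fromℕ l)) ≤ toℕ (index fz) + k) (Finₚ.toℕ-fromℕ l)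
        (rises-from-start {s = toℕ ∘ index} index-rises (fromℕ l)))

    index-along : toℕ i + l ≤ toℕ j → ∀ r → toℕ (index r) ≡ toℕ i + toℕ r
    index-along short r = trans (rises-tightly index-rises tight r) (cong (λ a → toℕ a + toℕ r) index-start)
      where
      tight : toℕ (index fz) + l ≤ toℕ (index (fromℕ l))
      tight = subst₂ (λ a b → toℕ a + l ≤ toℕ b) (sym index-start) (sym index-end) short

  walk-length-bound : ∀ {i j m} → Walk R (P i) (P j) m → toℕ j ≤ toℕ i + m
  walk-length-bound {i} u with shortest-walk R? u
  ... | _ , k≤m , γ = ≤-trans (OnGeodesic.geodesic-span γ) (+-monoʳ-≤ (toℕ i) k≤m)

  no-walk-shorter : ∀ {i j l k} → toℕ i + l ≤ toℕ j → k < l → ¬ Walk R (P i) (P j) k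
  no-walk-shorter {i} short k<l u = <⇒≱ (+-monoʳ-< (toℕ i) k<l) (≤-trans short (walk-length-bound u))

  TracesPath : ∀ {Q : Fin n → Fin n → Set} {i j l} → Walk Q (P i) (P j) l → Set
  TracesPath {i = i} u = ∀ r t → toℕ t ≡ toℕ i + toℕ r → Walk.w u r ≡ P t

  short-walk-traces-path : ∀ {i j l} (u : Walk R (P i) (P j) l) → toℕ i + l ≤ toℕ j →
                           toℕ i + l ≡ toℕ j × TracesPath u
  short-walk-traces-path {i} {j} {l} u short = ≤-antisym short (walk-length-bound u) , traces
    where
    γ : Geodesic R (P i) (P j) l
    γ = record { walk = u ; shortest = λ k k<l → no-walk-shorter short k<l }
    open OnGeodesic γ
    traces : TracesPath u
    traces r t t≡i+r = trans (index-spec r) (cong P (Finₚ.toℕ-injective (trans (index-along short r) (sym t≡i+r))))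

  short-lazy-walk-traces-path : ∀ {i j l} (u : Walk (Lazy R) (P i) (P j) l) → toℕ i + l ≤ toℕ j →
                                toℕ i + l ≡ toℕ j × TracesPath u
  short-lazy-walk-traces-path u short with strict-or-shorter u
  ... | inj₁ strict = short-walk-traces-path (strict-walk u strict) short
  ... | inj₂ (_ , k<l , v) = ⊥-elim (no-walk-shorter short k<l v)

module Diagonal (G H : Graph) {d : ℕ} {g : Fin d → Fin (Graph.n G)} {h : Fin d → Fin (Graph.n H)}
                (convexG : IsConvexPath (Graph.Adj G) d g) (convexH : IsConvexPath (Graph.Adj H) d h) where

  diagonal : Fin d → Fin (Graph.n G) × Fin (Graph.n H)
  diagonal i = g i , h i

  diagonal-consecutive : ∀ i j → toℕ j ≡ suc (toℕ i) → StrongAdj G H (diagonal i) (diagonal j)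
  diagonal-consecutive i j j≡1+i = distinct , inj₂ adjG , inj₂ (proj₂ (proj₁ convexH) i j j≡1+i)
    where
    adjG = proj₂ (proj₁ convexG) i j j≡1+i
    distinct : diagonal i ≢ diagonal j
    distinct same = Graph.irrefl G (subst (Graph.Adj G (g i)) (sym (cong proj₁ same)) adjG)

  geodesic-follows-diagonal : ∀ {a e l} (γ : Geodesic (StrongAdj G H) (diagonal a) (diagonal e) l) →
    toℕ a ≤ toℕ e →
    toℕ a + l ≡ toℕ e × (∀ r t → toℕ t ≡ toℕ a + toℕ r → Walk.w (Geodesic.walk γ) r ≡ diagonal t)
  geodesic-follows-diagonal {a} {e} {l} γ a≤e =
    proj₁ alongG , λ r t t≡a+r → cong₂ _,_ (proj₂ alongG r t t≡a+r) (proj₂ alongH r t t≡a+r)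
    where
    open ≤-Reasoning
    short : toℕ a + l ≤ toℕ e
    short = begin
      toℕ a + l                ≤⟨ +-monoʳ-≤ (toℕ a) (geodesic-minimal γ
                                    (path-segment diagonal-consecutive a _ e (m+[n∸m]≡n a≤e))) ⟩
      toℕ a + (toℕ e ∸ toℕ a)  ≡⟨ m+[n∸m]≡n a≤e ⟩
      toℕ e                    ∎
    alongG = ConvexPath.short-lazy-walk-traces-path (Graph.adj? G) convexG
               (walk-map proj₁ (λ adj → proj₁ (proj₂ adj)) (Geodesic.walk γ)) short
    alongH = ConvexPath.short-lazy-walk-traces-path (Graph.adj? H) convexH
               (walk-map proj₂ (λ adj → proj₂ (proj₂ adj)) (Geodesic.walk γ)) short

  imv-no-three-on-diagonal : ∀ {X} → IsIMV (StrongAdj G H) X → ∀ {a b e} → a Fin.< b → b Fin.< e →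
                             X (diagonal a) → X (diagonal b) → X (diagonal e) → ⊥
  imv-no-three-on-diagonal {X} (_ , visible) {a} {b} {e} a<b b<e Xa Xb Xe
    with l , γ , avoids ← visible _ _ Xa Xe
    with a+l≡e , along ← geodesic-follows-diagonal γ (<⇒≤ (<-trans a<b b<e)) =
    avoids r (subst (0 <_) (sym r≡gap) (m<n⇒0<n∸m a<b)) (subst (_< l) (sym r≡gap) gap<l)
      (subst X (sym (along r b (trans b≡a+gap (cong (toℕ a +_) (sym r≡gap))))) Xb)
    where
    gap = toℕ b ∸ toℕ a
    b≡a+gap : toℕ b ≡ toℕ a + gap
    b≡a+gap = sym (m+[n∸m]≡n (<⇒≤ a<b))
    gap<l : gap < l
    gap<l = +-cancelˡ-< (toℕ a) gap l (subst₂ _<_ b≡a+gap (sym a+l≡e) b<e)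
    r : Fin (suc l)
    r = fromℕ< (m<n⇒m<1+n gap<l)
    r≡gap : toℕ r ≡ gap
    r≡gap = Finₚ.toℕ-fromℕ< (m<n⇒m<1+n gap<l)

module _ {d c : ℕ} (f : Fin d → Fin c) where

  AtMostTwoPerFibre : Set
  AtMostTwoPerFibre = ∀ {i j k} → i Fin.< j → j Fin.< k → f i ≡ f j → f j ≡ f k → ⊥

  at-most-two-per-fibre⇒≤+ : AtMostTwoPerFibre → d ≤ c + c
  at-most-two-per-fibre⇒≤+ two = Finₚ.injective⇒≤ λ {i} {j} → mark-injective (repeats? i) (repeats? j) ∘ join-injective
    where
    Repeats : Fin d → Set
    Repeats i = ∃[ k ] k Fin.< i × f k ≡ f i

    repeats? : ∀ i → Dec (Repeats i)
    repeats? i = Finₚ.any? λ k → k Finₚ.<? i ×-dec f k Finₚ.≟ f i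

    -- injective because a fibre has at most one element repeating an earlier one
    mark : ∀ i → Dec (Repeats i) → Fin c ⊎ Fin c
    mark i (yes _) = inj₂ (f i)
    mark i (no _)  = inj₁ (f i)

    mark-injective : ∀ {i j} (ri : Dec (Repeats i)) (rj : Dec (Repeats j)) → mark i ri ≡ mark j rj → i ≡ j
    mark-injective (yes _) (no _) ()
    mark-injective (no _) (yes _) ()
    mark-injective {i} {j} (yes (k , k<i , fk≡fi)) (yes (k′ , k′<j , fk′≡fj)) same with Finₚ.<-cmp i j
    ... | tri< i<j _ _ = ⊥-elim (two k<i i<j fk≡fi (inj₂-injective same))
    ... | tri≈ _ i≡j _ = i≡j
    ... | tri> _ _ j<i = ⊥-elim (two k′<j j<i fk′≡fj (sym (inj₂-injective same)))
    mark-injective {i} {j} (no ¬ri) (no ¬rj) same with Finₚ.<-cmp i j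
    ... | tri< i<j _ _ = ⊥-elim (¬rj (i , i<j , inj₁-injective same))
    ... | tri≈ _ i≡j _ = i≡j
    ... | tri> _ _ j<i = ⊥-elim (¬ri (j , j<i , sym (inj₁-injective same)))

    join-injective : ∀ {x y} → join c c x ≡ join c c y → x ≡ y
    join-injective {x} {y} same =
      trans (sym (Finₚ.splitAt-join c c x)) (trans (cong (splitAt c) same) (Finₚ.splitAt-join c c y))

module _ {V : Set} {Adj : V → V → Set} where

  clique-injective : (∀ {x} → ¬ Adj x x) → ∀ {a f} → IsClique Adj a f → ∀ {i j} → f i ≡ f j → i ≡ j
  clique-injective irrefl clique {i} {j} fi≡fj with i Finₚ.≟ j
  ... | yes i≡j = i≡j
  ... | no i≢j  = ⊥-elim (irrefl (subst (Adj _) (sym fi≡fj) (clique i j i≢j)))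

  clique-lazy : ∀ {a f} → IsClique Adj a f → ∀ i j → Lazy Adj (f i) (f j)
  clique-lazy {f = f} clique i j with i Finₚ.≟ j
  ... | yes i≡j = inj₁ (cong f i≡j)
  ... | no i≢j  = inj₂ (clique i j i≢j)

  imv-partition-proper : ∀ {k} ((col , _) : IMVPartition Adj k) → ∀ {x y} → col x ≡ col y → ¬ Adj x y
  imv-partition-proper (col , imv) {x} {y} same = proj₁ (imv (col y)) x y same refl

  proper-colouring-bounds-clique : ∀ {k} (col : V → Fin k) → (∀ {x y} → col x ≡ col y → ¬ Adj x y) →
                                   ∀ {a} → HasClique Adj a → a ≤ k
  proper-colouring-bounds-clique col proper (f , clique) = Finₚ.injective⇒≤ col∘f-injective
    where
    col∘f-injective : ∀ {i j} → col (f i) ≡ col (f j) → i ≡ j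
    col∘f-injective {i} {j} same with i Finₚ.≟ j
    ... | yes i≡j = i≡j
    ... | no i≢j  = ⊥-elim (proper same (clique i j i≢j))

strong-product-clique : (G H : Graph) → ∀ {a b} → HasClique (Graph.Adj G) a → HasClique (Graph.Adj H) b →
                        HasClique (StrongAdj G H) (a * b)
strong-product-clique G H {a} {b} (fG , cliqueG) (fH , cliqueH) = vertex , adjacent
  where
  coordinates : Fin (a * b) → Fin a × Fin b
  coordinates = remQuot b

  coordinates-injective : ∀ {i j} → coordinates i ≡ coordinates j → i ≡ j
  coordinates-injective {i} {j} same =
    trans (sym (Finₚ.combine-remQuot {a} b i)) (trans (cong (uncurry combine) same) (Finₚ.combine-remQuot {a} b j))

  vertex : Fin (a * b) → Fin (Graph.n G) × Fin (Graph.n H)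
  vertex i = fG (proj₁ (coordinates i)) , fH (proj₂ (coordinates i))

  adjacent : IsClique (StrongAdj G H) (a * b) vertex
  adjacent i j i≢j = distinct , clique-lazy {Adj = Graph.Adj G} {f = fG} cliqueG _ _
                             , clique-lazy {Adj = Graph.Adj H} {f = fH} cliqueH _ _
    where
    distinct : vertex i ≢ vertex j
    distinct same = i≢j (coordinates-injective (cong₂ _,_
      (clique-injective {Adj = Graph.Adj G} (Graph.irrefl G) {f = fG} cliqueG (cong proj₁ same))
      (clique-injective {Adj = Graph.Adj H} (Graph.irrefl H) {f = fH} cliqueH (cong proj₂ same))))

theorem5p5 : (G H : Graph) →
    Connected (Graph.Adj G) → Connected (Graph.Adj H) →
    (c d wG wH : ℕ) →
    IsChiMuI (StrongAdj G H) c →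
    IsDiagNumber G H d →
    IsCliqueNumber (Graph.Adj G) wG →
    IsCliqueNumber (Graph.Adj H) wH →
    (⌈ d /2⌉ ⊔ (wG * wH)) ≤ c
theorem5p5 G H _ _ c d wG wH (partition@(col , imv) , _) ((_ , _ , convexG , convexH) , _) (cliqueG , _) (cliqueH , _) =
  ⊔-lub diagonal-bound clique-bound
  where
  open Diagonal G H convexG convexH

  colour-twice-on-diagonal : AtMostTwoPerFibre (col ∘ diagonal)
  colour-twice-on-diagonal i<j j<k same₁ same₂ =
    imv-no-three-on-diagonal (imv _) i<j j<k same₁ refl (sym same₂)

  diagonal-bound : ⌈ d /2⌉ ≤ c
  diagonal-bound = ≤-trans (⌈n/2⌉-mono (at-most-two-per-fibre⇒≤+ _ colour-twice-on-diagonal))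
                           (≤-reflexive (sym (n≡⌈n+n/2⌉ c)))

  clique-bound : wG * wH ≤ c
  clique-bound = proper-colouring-bounds-clique col (imv-partition-proper partition)
                   (strong-product-clique G H cliqueG cliqueH)
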